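{- Let $G$ be a long-refinement graph. Then $|\{v \in V(G) \mid \deg(v) = 1\}| \leq 2$.
   Context: All graphs are finite, simple, undirected, with monochromatic initial colouring. Colour Refinement computes $\chi^0_G$ constant and $\chi^i_G(v) = \big(\chi^{i-1}_G(v), \{\!\{\chi^{i-1}_G(w) \mid w \in N(v)\}\!\}\big)$; $\pi^i_G$ is the partition of $V(G)$ into colour classes of $\chi^i_G$, and $\mathrm{WL}_1(G)$ is the least $j \geq 0$ with $\pi^j_G = \pi^{j+1}_G$. A long-refinement graph is a graph $G$ with $\mathrm{WL}_1(G) = |G|-1$. -}

module Defs where

open import Data.Nat using (ℕ; zero; suc; _<_; _≤_; _≡ᵇ_)
open import Data.Bool using (Bool; true; false; _∧_; T)
open import Data.Fin using (Fin)
open import Data.List using (List; filter; length; allFin)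
open import Data.Bool.ListAction using (all)
open import Data.Product using (_×_; Σ)
open import Relation.Binary.PropositionalEquality using (_≡_)
open import Relation.Nullary using (¬_)
open import Data.Bool.Properties using (T?)

record Graph (n : ℕ) : Set where
  field
    adj    : Fin n → Fin n → Bool
    sym    : ∀ u v → adj u v ≡ adj v u
    irrefl : ∀ v → adj v v ≡ false
open Graph public

order : ∀ {n} → Graph n → ℕ
order {n} _ = n

N : ∀ {n} → Graph n → Fin n → List (Fin n)
N G v = filter (λ w → T? (adj G v w)) (allFin _)

deg : ∀ {n} → Graph n → Fin n → ℕ
deg G v = length (N G v)

countᵇ : ∀ {n} → (Fin n → Bool) → List (Fin n) → ℕ
countᵇ p xs = length (filter (λ x → T? (p x)) xs)

-- sameColour G i v w = true  iff  χ^i_G(v) = χ^i_G(w).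
-- χ^0 is constant; χ^{i+1}(v) = χ^{i+1}(w) iff χ^i(v) = χ^i(w) and the
-- multisets {{χ^i(u) | u ∈ N(v)}} and {{χ^i(u) | u ∈ N(w)}} coincide, i.e.
-- every colour (each colour of round i is the colour of some vertex x)
-- has the same multiplicity in both.
sameColour : ∀ {n} → Graph n → ℕ → Fin n → Fin n → Bool
sameColour G zero    v w = true
sameColour G (suc i) v w =
  sameColour G i v w ∧
  all (λ x → countᵇ (sameColour G i x) (N G v) ≡ᵇ countᵇ (sameColour G i x) (N G w))
      (allFin _)

Stable : ∀ {n} → Graph n → ℕ → Set
Stable G j = ∀ v w → sameColour G j v w ≡ sameColour G (suc j) v w

IsWL1 : ∀ {n} → Graph n → ℕ → Set
IsWL1 G j = Stable G j × (∀ k → k < j → ¬ Stable G k)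

-- long-refinement graph: WL₁(G) = |G| - 1   (i.e. WL₁(G) + 1 = |G|)
LongRefinement : ∀ {n} → Graph n → Set
LongRefinement {n} G = Σ ℕ λ j → IsWL1 G j × suc j ≡ n

numDeg1 : ∀ {n} → Graph n → ℕ
numDeg1 {n} G = countᵇ (λ v → deg G v ≡ᵇ 1) (allFin n)

module Submission where

-- Colour classes are counted through their representatives (least
-- vertices of a class).  The count is 1 after round 0, grows by at least one in
-- every round that changes the partition, and never exceeds |G|.  For a
-- long-refinement graph with WL₁(G) = j = |G| - 1 this forces exactly k + 1
-- classes after every round k ≤ j: no round before j creates two new classes,
-- and the partition after round j is discrete.
--
-- Suppose u₁, u₂, u₃ are distinct leaves.  They share a colour after round 1
-- and are separated after round j; let p ≥ 1 be the last round after which u₁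
-- has the colour of both u₂ and u₃.  If p + 1 = j, the class of u₁ splits into
-- three classes at once.  Otherwise the class of u₁ is the only class split in
-- round p + 1, and since it consists of leaves the partition is stable after
-- round p + 1 < j, contradicting WL₁(G) = j.

open import Data.Bool using (true; false; T)
open import Data.Bool.Properties using (T?; T-∧) renaming (_≟_ to _≟ᴮ_)
open import Data.Empty using (⊥; ⊥-elim)
open import Data.Fin using (Fin; toℕ; _≟_) renaming (zero to fzero; suc to fsuc)
open import Data.Fin.Properties using (toℕ-injective; all?; any?; ¬∀⟶∃¬)
open import Data.List using (List; []; _∷_; length; filter; allFin)
open import Data.List.Membership.Propositional using (_∈_; lose)
open import Data.List.Membership.Propositional.Properties using (∈-allFin; ∈-filter⁺; ∈-filter⁻)
open import Data.List.Properties
  using (length-filter; filter-all; filter-none; filter-some; filter-complete; length-tabulate)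
import Data.List.Relation.Unary.All as All
open import Data.List.Relation.Unary.All.Properties using (all⁺; all⁻)
open import Data.List.Relation.Unary.Any using (here; there)
open import Data.List.Relation.Unary.AllPairs using () renaming (_∷_ to _∷ᴾ_)
open import Data.List.Relation.Unary.Unique.Propositional using (Unique)
import Data.List.Relation.Unary.Unique.Propositional.Properties as Unique
open import Data.Nat using (ℕ; _≡ᵇ_; zero; suc; _+_; _∸_; _≤_; _<_; z≤n; s≤s; _≤′_; ≤′-refl; ≤′-step; _<?_)
open import Data.Nat.Properties
  using (≤-refl; ≤-reflexive; ≤-trans; ≤-antisym; <⇒≤; <-cmp; m≤n⇒m≤1+n; m≤n⇒m<n∨m≡n;
         ≤⇒≤′; ≤′⇒≤; n≢0⇒n>0; n>0⇒n≢0; n≤0⇒n≡0; +-suc; +-identityʳ; +-monoˡ-≤;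
         +-cancelʳ-≤; m+[n∸m]≡n; m≤m+n; 1+n≰n; ≡ᵇ⇒≡; ≡⇒≡ᵇ; module ≤-Reasoning)
open import Data.Product using (Σ; ∃; _×_; _,_; proj₁; proj₂)
open import Data.Sum using (inj₁; inj₂)
open import Function using (id; _∘_; Equivalence)
open import Level using (0ℓ)
open import Relation.Binary.Definitions using (DecidableEquality; tri<; tri≈; tri>)
open import Relation.Binary.PropositionalEquality using (_≡_; _≢_; refl; sym; trans; cong; subst; subst₂; module ≡-Reasoning)
open import Relation.Nullary using (¬_; Dec; yes; no; contradiction)
open import Relation.Nullary.Decidable using (_→-dec_; _×-dec_; ¬?)
open import Relation.Unary using (Pred; Decidable; _∪_)
open import Relation.Unary.Properties using (_∪?_)

open import Defs hiding (sym)

count : {A : Set} {P : Pred A 0ℓ} → Decidable P → List A → ℕ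
count P? xs = length (filter P? xs)

module _ {A : Set} {P Q : Pred A 0ℓ} (P? : Decidable P) (Q? : Decidable Q) where

  count-mono : ∀ xs → (∀ {x} → x ∈ xs → P x → Q x) → count P? xs ≤ count Q? xs
  count-mono [] P⇒Q = z≤n
  count-mono (y ∷ ys) P⇒Q with P? y | Q? y
  ... | yes _  | yes _  = s≤s (count-mono ys (P⇒Q ∘ there))
  ... | yes Py | no ¬Qy = contradiction (P⇒Q (here refl) Py) ¬Qy
  ... | no _   | yes _  = m≤n⇒m≤1+n (count-mono ys (P⇒Q ∘ there))
  ... | no _   | no _   = count-mono ys (P⇒Q ∘ there)

  count-strict : ∀ xs → (∀ {x} → x ∈ xs → P x → Q x) →
                 ∀ {x} → x ∈ xs → Q x → ¬ P x → suc (count P? xs) ≤ count Q? xs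
  count-strict (y ∷ ys) P⇒Q (here refl) Qx ¬Px with P? y | Q? y
  ... | yes Py | _      = contradiction Py ¬Px
  ... | no _   | no ¬Qy = contradiction Qx ¬Qy
  ... | no _   | yes _  = s≤s (count-mono ys (P⇒Q ∘ there))
  count-strict (y ∷ ys) P⇒Q (there x∈ys) Qx ¬Px with P? y | Q? y
  ... | yes _  | yes _  = s≤s (count-strict ys (P⇒Q ∘ there) x∈ys Qx ¬Px)
  ... | yes Py | no ¬Qy = contradiction (P⇒Q (here refl) Py) ¬Qy
  ... | no _   | yes _  = m≤n⇒m≤1+n (count-strict ys (P⇒Q ∘ there) x∈ys Qx ¬Px)
  ... | no _   | no _   = count-strict ys (P⇒Q ∘ there) x∈ys Qx ¬Px

count-cong : {A : Set} {P Q : Pred A 0ℓ} (P? : Decidable P) (Q? : Decidable Q) →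
             ∀ xs → (∀ {x} → x ∈ xs → P x → Q x) → (∀ {x} → x ∈ xs → Q x → P x) →
             count P? xs ≡ count Q? xs
count-cong P? Q? xs P⇒Q Q⇒P =
  ≤-antisym (count-mono P? Q? xs P⇒Q) (count-mono Q? P? xs Q⇒P)

-- Two distinct elements satisfying Q but not P raise the count by two:
-- pass through the intermediate predicate "P or equal to the first one".
count-strict₂ : {A : Set} {P Q : Pred A 0ℓ} → DecidableEquality A →
                (P? : Decidable P) (Q? : Decidable Q) →
                ∀ xs → (∀ {x} → x ∈ xs → P x → Q x) →
                ∀ {x y} → x ≢ y → x ∈ xs → y ∈ xs → Q x → ¬ P x → Q y → ¬ P y →
                suc (suc (count P? xs)) ≤ count Q? xs
count-strict₂ {P = P} {Q} _≟ᴬ_ P? Q? xs P⇒Q {x} {y} x≢y x∈xs y∈xs Qx ¬Px Qy ¬Py =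
  ≤-trans (s≤s (count-strict P? P∪x? xs (λ _ → inj₁) x∈xs (inj₂ refl) ¬Px))
          (count-strict P∪x? Q? xs P∪x⇒Q y∈xs Qy ¬P∪x)
  where
    P∪x? : Decidable (P ∪ (_≡ x))
    P∪x? = P? ∪? (_≟ᴬ x)
    P∪x⇒Q : ∀ {z} → z ∈ xs → (P ∪ (_≡ x)) z → Q z
    P∪x⇒Q z∈xs (inj₁ Pz)   = P⇒Q z∈xs Pz
    P∪x⇒Q z∈xs (inj₂ refl) = Qx
    ¬P∪x : ¬ (P ∪ (_≡ x)) y
    ¬P∪x (inj₁ Py)   = ¬Py Py
    ¬P∪x (inj₂ refl) = x≢y refl

module _ {A : Set} {P : Pred A 0ℓ} (P? : Decidable P) where

  count-all : ∀ xs → (∀ {x} → x ∈ xs → P x) → count P? xs ≡ length xs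
  count-all xs all = cong length (filter-all P? (All.tabulate all))

  count-none : ∀ xs → (∀ {x} → x ∈ xs → ¬ P x) → count P? xs ≡ 0
  count-none xs none = cong length (filter-none P? (All.tabulate none))

  count-pos : ∀ {x xs} → x ∈ xs → P x → 0 < count P? xs
  count-pos x∈xs Px = filter-some P? (lose x∈xs Px)

  count-full : ∀ {x xs} → count P? xs ≡ length xs → x ∈ xs → P x
  count-full {x} {xs} full x∈xs = proj₂ (∈-filter⁻ P? {xs = xs} (subst (x ∈_) (sym (filter-complete P? full)) x∈xs))

  count-singleton : ∀ {x y} → (P x → P y) → (P y → P x) → count P? (x ∷ []) ≡ count P? (y ∷ [])
  count-singleton {x} {y} x⇒y y⇒x with P? x | P? y
  ... | yes _  | yes _  = refl
  ... | no _   | no _   = refl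
  ... | yes Px | no ¬Py = contradiction (x⇒y Px) ¬Py
  ... | no ¬Px | yes Py = contradiction (y⇒x Py) ¬Px

T-ext : ∀ {a b} → (T a → T b) → (T b → T a) → a ≡ b
T-ext {true}  {true}  _ _ = refl
T-ext {true}  {false} f _ = ⊥-elim (f _)
T-ext {false} {true}  _ g = ⊥-elim (g _)
T-ext {false} {false} _ _ = refl

least : ∀ {n} {P : Pred (Fin n) 0ℓ} → Decidable P → ∀ {x} → P x →
        Σ (Fin n) λ m → P m × (∀ u → toℕ u < toℕ m → ¬ P u)
least {suc n} {P} P? {x} Px with P? fzero
... | yes P0 = fzero , P0 , λ _ ()
least {suc n} {P} P? {fzero}  Px | no ¬P0 = contradiction Px ¬P0
least {suc n} {P} P? {fsuc x} Px | no ¬P0 with least (P? ∘ fsuc) Px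
... | m , Pm , below = fsuc m , Pm , smaller
  where
    smaller : ∀ u → toℕ u < toℕ (fsuc m) → ¬ P u
    smaller fzero    _         = ¬P0
    smaller (fsuc u) (s≤s u<m) = below u u<m

crossing : {P : Pred ℕ 0ℓ} → Decidable P → ∀ {a j} → P a → a ≤ j → ¬ P j →
           Σ ℕ λ p → a ≤ p × p < j × P p × ¬ P (suc p)
crossing {P} P? {a} Pa a≤j ¬Pj = go (≤⇒≤′ a≤j) ¬Pj
  where
    go : ∀ {j} → a ≤′ j → ¬ P j → Σ ℕ λ p → a ≤ p × p < j × P p × ¬ P (suc p)
    go ≤′-refl ¬Pa = contradiction Pa ¬Pa
    go {suc j} (≤′-step a≤′j) ¬Psj with P? j
    ... | yes Pj = j , ≤′⇒≤ a≤′j , ≤-refl , Pj , ¬Psj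
    ... | no ¬Pj with go a≤′j ¬Pj
    ...   | p , a≤p , p<j , Pp , ¬Psp = p , a≤p , m≤n⇒m≤1+n p<j , Pp , ¬Psp

length≤2 : {A : Set} → ∀ {xs : List A} → Unique xs →
           (∀ {x y z} → x ∈ xs → y ∈ xs → z ∈ xs → x ≢ y → x ≢ z → y ≢ z → ⊥) →
           length xs ≤ 2
length≤2 {xs = []}              _ _ = z≤n
length≤2 {xs = _ ∷ []}          _ _ = s≤s z≤n
length≤2 {xs = _ ∷ _ ∷ []}      _ _ = s≤s (s≤s z≤n)
length≤2 {xs = _ ∷ _ ∷ _ ∷ _} ((x≢y All.∷ x≢z All.∷ _) ∷ᴾ (y≢z All.∷ _) ∷ᴾ _) noThree =
  ⊥-elim (noThree (here refl) (there (here refl)) (there (there (here refl))) x≢y x≢z y≢z)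

module Refinement {n : ℕ} (G : Graph n) where

  _≈[_]_ : Fin n → ℕ → Fin n → Set
  u ≈[ k ] v = T (sameColour G k u v)

  ≈? : ∀ k u v → Dec (u ≈[ k ] v)
  ≈? k u v = T? (sameColour G k u v)

  nbrs : ℕ → Fin n → Fin n → ℕ
  nbrs k y v = count (≈? k y) (N G v)

  ≈-step : ∀ k {u v} → u ≈[ k ] v → (∀ y → nbrs k y u ≡ nbrs k y v) → u ≈[ suc k ] v
  ≈-step k {u} {v} u≈v equal =
    Equivalence.from (T-∧ {sameColour G k u v}) (u≈v , all⁻ _ {xs = allFin n} (All.tabulate λ {y} _ → ≡⇒≡ᵇ _ _ (equal y)))

  ≈-pred : ∀ k {u v} → u ≈[ suc k ] v → u ≈[ k ] v
  ≈-pred k {u} {v} = proj₁ ∘ Equivalence.to (T-∧ {sameColour G k u v})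

  ≈-nbrs : ∀ k {u v} → u ≈[ suc k ] v → ∀ y → nbrs k y u ≡ nbrs k y v
  ≈-nbrs k {u} {v} u≈v y =
    ≡ᵇ⇒≡ _ _ (All.lookup (all⁺ _ (allFin n) (proj₂ (Equivalence.to (T-∧ {sameColour G k u v}) u≈v))) (∈-allFin y))

  ≈-refl : ∀ k {v} → v ≈[ k ] v
  ≈-refl zero    = _
  ≈-refl (suc k) = ≈-step k (≈-refl k) (λ _ → refl)

  ≈-sym : ∀ k {u v} → u ≈[ k ] v → v ≈[ k ] u
  ≈-sym zero    _   = _
  ≈-sym (suc k) u≈v = ≈-step k (≈-sym k (≈-pred k u≈v)) (λ y → sym (≈-nbrs k u≈v y))

  ≈-trans : ∀ k {u v w} → u ≈[ k ] v → v ≈[ k ] w → u ≈[ k ] w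
  ≈-trans zero    _   _   = _
  ≈-trans (suc k) u≈v v≈w =
    ≈-step k (≈-trans k (≈-pred k u≈v) (≈-pred k v≈w)) (λ y → trans (≈-nbrs k u≈v y) (≈-nbrs k v≈w y))

  ≈-≉ : ∀ k {u v w} → u ≈[ k ] v → ¬ v ≈[ k ] w → ¬ u ≈[ k ] w
  ≈-≉ k u≈v v≉w u≈w = v≉w (≈-trans k (≈-sym k u≈v) u≈w)

  ≈-antitone : ∀ {k l u v} → k ≤ l → u ≈[ l ] v → u ≈[ k ] v
  ≈-antitone k≤l = go (≤⇒≤′ k≤l)
    where
      go : ∀ {k l u v} → k ≤′ l → u ≈[ l ] v → u ≈[ k ] v
      go ≤′-refl u≈v = u≈v
      go {l = suc l} (≤′-step k≤′l) u≈v = go k≤′l (≈-pred l u≈v)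

  nbrs-zero : ∀ y v → nbrs 0 y v ≡ deg G v
  nbrs-zero y v = count-all (≈? 0 y) (N G v) (λ _ → _)

  ≈-deg : ∀ {k u v} → 1 ≤ k → u ≈[ k ] v → deg G u ≡ deg G v
  ≈-deg {u = u} {v} 1≤k u≈v =
    trans (sym (nbrs-zero u u)) (trans (≈-nbrs 0 (≈-antitone 1≤k u≈v) u) (nbrs-zero u v))

  deg-≈₁ : ∀ {u v} → deg G u ≡ deg G v → u ≈[ 1 ] v
  deg-≈₁ {u} {v} du≡dv = ≈-step 0 _ (λ y → trans (nbrs-zero y u) (trans du≡dv (sym (nbrs-zero y v))))

  Adj : Fin n → Fin n → Set
  Adj v w = T (adj G v w)

  Adj-sym : ∀ {v w} → Adj v w → Adj w v
  Adj-sym {v} {w} = subst T (Graph.sym G v w)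

  ∈N⁺ : ∀ {v w} → Adj v w → w ∈ N G v
  ∈N⁺ {v} {w} a = ∈-filter⁺ (λ x → T? (adj G v x)) (∈-allFin w) a

  ∈N⁻ : ∀ {v w} → w ∈ N G v → Adj v w
  ∈N⁻ {v} w∈N = proj₂ (∈-filter⁻ (λ x → T? (adj G v x)) {xs = allFin n} w∈N)

  leaf-N : ∀ {z w} → deg G z ≡ 1 → Adj z w → N G z ≡ w ∷ []
  leaf-N {z} dz a = unique (N G z) dz (∈N⁺ a)
    where
      unique : ∀ {w} (L : List (Fin n)) → length L ≡ 1 → w ∈ L → L ≡ w ∷ []
      unique (_ ∷ []) _ (here refl) = refl

  leaf-≈ : ∀ k {z z' v v'} → deg G z ≡ 1 → deg G z' ≡ 1 → Adj z v → Adj z' v' →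
           z ≈[ k ] z' → v ≈[ k ] v' → z ≈[ suc k ] z'
  leaf-≈ k {z} {z'} {v} {v'} dz dz' a a' z≈z' v≈v' = ≈-step k z≈z' λ y → begin
    nbrs k y z                  ≡⟨ cong (count (≈? k y)) (leaf-N dz a) ⟩
    count (≈? k y) (v ∷ [])     ≡⟨ count-singleton (≈? k y) (λ e → ≈-trans k e v≈v') (λ e → ≈-trans k e (≈-sym k v≈v')) ⟩
    count (≈? k y) (v' ∷ [])    ≡⟨ cong (count (≈? k y)) (sym (leaf-N dz' a')) ⟩
    nbrs k y z'                 ∎
    where open ≡-Reasoning

  stable-from : ∀ k → (∀ {v w} → v ≈[ k ] w → v ≈[ suc k ] w) → Stable G k
  stable-from k keep v w = T-ext keep (≈-pred k)

  -- Suppose that in round p+1 (p ≥ 1) the only class that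
  -- splits is the round-p class of a leaf u.  That class consists of leaves;
  -- around any vertex its members are then either all separated from a given
  -- round-(p+1) colour or all share it, so the partition after round p+1 is
  -- already stable.
  module LeafSplit (p : ℕ) {u : Fin n} (1≤p : 1 ≤ p) (leaf-u : deg G u ≡ 1)
                   (only-u : ∀ {y z} → y ≈[ p ] z → ¬ y ≈[ suc p ] z → y ≈[ p ] u) where

    q : ℕ
    q = suc p

    -- Outside the class of u nothing splits, so counts do not change.
    nbrs-unsplit : ∀ {y} → ¬ y ≈[ p ] u → ∀ x → nbrs q y x ≡ nbrs p y x
    nbrs-unsplit {y} ¬y≈u x = count-cong (≈? q y) (≈? p y) (N G x) (λ _ → ≈-pred p) (λ _ → kept)
      where
        kept : ∀ {z} → y ≈[ p ] z → y ≈[ q ] z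
        kept {z} y≈z with ≈? q y z
        ... | yes y≈z' = y≈z'
        ... | no y≉z'  = contradiction (only-u y≈z y≉z') ¬y≈u

    leaf-in-class : ∀ {y z} → y ≈[ p ] u → y ≈[ p ] z → deg G z ≡ 1
    leaf-in-class y≈u y≈z = trans (≈-deg 1≤p (≈-trans p (≈-sym p y≈z) y≈u)) leaf-u

    nbr-≈ : ∀ {y x x' z z'} → y ≈[ p ] u → x ≈[ p ] x' → Adj x z → y ≈[ p ] z →
            Adj x' z' → y ≈[ p ] z' → z ≈[ q ] z'
    nbr-≈ y≈u x≈x' a y≈z a' y≈z' =
      leaf-≈ p (leaf-in-class y≈u y≈z) (leaf-in-class y≈u y≈z') (Adj-sym a) (Adj-sym a')
             (≈-trans p (≈-sym p y≈z) y≈z') x≈x'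

    nbrs-kept : ∀ {y x z} → y ≈[ p ] u → Adj x z → y ≈[ p ] z → y ≈[ q ] z → nbrs q y x ≡ nbrs p y x
    nbrs-kept {y} {x} y≈u a y≈z y≈z' = count-cong (≈? q y) (≈? p y) (N G x) (λ _ → ≈-pred p)
      (λ z'∈N y≈z'' → ≈-trans q y≈z' (nbr-≈ y≈u (≈-refl p) a y≈z (∈N⁻ z'∈N) y≈z''))

    nbrs-lost : ∀ {y x z} → y ≈[ p ] u → Adj x z → y ≈[ p ] z → ¬ y ≈[ q ] z → nbrs q y x ≡ 0
    nbrs-lost {y} {x} y≈u a y≈z y≉z = count-none (≈? q y) (N G x)
      (λ z'∈N y≈z' → y≉z (≈-trans q y≈z' (nbr-≈ y≈u (≈-refl p) (∈N⁻ z'∈N) (≈-pred p y≈z') a y≈z)))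

    nbrs-≤ : ∀ y x → nbrs q y x ≤ nbrs p y x
    nbrs-≤ y x = count-mono (≈? q y) (≈? p y) (N G x) (λ _ → ≈-pred p)

    HasNbr : Fin n → Fin n → Set
    HasNbr y x = ∃ λ z → Adj x z × y ≈[ p ] z

    hasNbr? : ∀ y x → Dec (HasNbr y x)
    hasNbr? y x = any? (λ z → T? (adj G x z) ×-dec ≈? p y z)

    nbrs-none-p : ∀ {y x} → ¬ HasNbr y x → nbrs p y x ≡ 0
    nbrs-none-p {y} {x} ¬has = count-none (≈? p y) (N G x) (λ z∈N y≈z → ¬has (_ , ∈N⁻ z∈N , y≈z))

    nbrs-none-q : ∀ {y x} → ¬ HasNbr y x → nbrs q y x ≡ 0
    nbrs-none-q {y} {x} ¬has = n≤0⇒n≡0 (subst (nbrs q y x ≤_) (nbrs-none-p ¬has) (nbrs-≤ y x))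

    hasNbr-resp : ∀ {y v w} → v ≈[ q ] w → HasNbr y v → ¬ HasNbr y w → ⊥
    hasNbr-resp {y} v≈w (z , a , y≈z) ¬has =
      n>0⇒n≢0 (count-pos (≈? p y) (∈N⁺ a) y≈z) (trans (≈-nbrs p v≈w y) (nbrs-none-p ¬has))

    -- If v ≈[ q ] w have neighbours zv, zw in the class of y ≈ u, these keep
    -- equal colours, so the class of y loses or keeps its count around both.
    nbrs-both : ∀ {y v w zv zw} → y ≈[ p ] u → v ≈[ q ] w →
                Adj v zv → y ≈[ p ] zv → Adj w zw → y ≈[ p ] zw → zv ≈[ q ] zw →
                Dec (y ≈[ q ] zv) → nbrs q y v ≡ nbrs q y w
    nbrs-both {y} {v} {w} y≈u v≈w av y≈zv aw y≈zw zv≈zw (yes y≈zv') = begin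
      nbrs q y v ≡⟨ nbrs-kept y≈u av y≈zv y≈zv' ⟩
      nbrs p y v ≡⟨ ≈-nbrs p v≈w y ⟩
      nbrs p y w ≡⟨ sym (nbrs-kept y≈u aw y≈zw (≈-trans q y≈zv' zv≈zw)) ⟩
      nbrs q y w ∎
      where open ≡-Reasoning
    nbrs-both y≈u v≈w av y≈zv aw y≈zw zv≈zw (no y≉zv') =
      trans (nbrs-lost y≈u av y≈zv y≉zv')
            (sym (nbrs-lost y≈u aw y≈zw (λ y≈zw' → y≉zv' (≈-trans q y≈zw' (≈-sym q zv≈zw)))))

    nbrs-leafClass : ∀ {y v w} → y ≈[ p ] u → v ≈[ q ] w → nbrs q y v ≡ nbrs q y w
    nbrs-leafClass {y} {v} {w} y≈u v≈w with hasNbr? y v | hasNbr? y w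
    ... | no ¬hv | no ¬hw = trans (nbrs-none-q ¬hv) (sym (nbrs-none-q ¬hw))
    ... | yes hv | no ¬hw = ⊥-elim (hasNbr-resp v≈w hv ¬hw)
    ... | no ¬hv | yes hw = ⊥-elim (hasNbr-resp (≈-sym q v≈w) hw ¬hv)
    ... | yes (zv , av , y≈zv) | yes (zw , aw , y≈zw) =
      nbrs-both y≈u v≈w av y≈zv aw y≈zw (nbr-≈ y≈u (≈-pred p v≈w) av y≈zv aw y≈zw) (≈? q y zv)

    nbrs-stable : ∀ {v w} → v ≈[ q ] w → ∀ y → nbrs q y v ≡ nbrs q y w
    nbrs-stable {v} {w} v≈w y with ≈? p y u
    ... | yes y≈u = nbrs-leafClass y≈u v≈w
    ... | no ¬y≈u = begin
      nbrs q y v ≡⟨ nbrs-unsplit ¬y≈u v ⟩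
      nbrs p y v ≡⟨ ≈-nbrs p v≈w y ⟩
      nbrs p y w ≡⟨ sym (nbrs-unsplit ¬y≈u w) ⟩
      nbrs q y w ∎
      where open ≡-Reasoning

    stable : Stable G q
    stable = stable-from q (λ {v} {w} v≈w → ≈-step q v≈w (nbrs-stable v≈w))

module Classes {n : ℕ} (G : Graph n) where
  open Refinement G

  IsRep : ℕ → Fin n → Set
  IsRep k v = ∀ u → toℕ u < toℕ v → ¬ u ≈[ k ] v

  isRep? : ∀ k → Decidable (IsRep k)
  isRep? k v = all? (λ u → (toℕ u <? toℕ v) →-dec ¬? (≈? k u v))

  classes : ℕ → ℕ
  classes k = count (isRep? k) (allFin n)

  classes-≤ : ∀ k → classes k ≤ n
  classes-≤ k = subst (classes k ≤_) (length-tabulate id) (length-filter (isRep? k) (allFin n))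

  -- Classes only split, so representatives remain representatives.
  rep-mono : ∀ k {v} → IsRep k v → IsRep (suc k) v
  rep-mono k rep-v u u<v u≈v = rep-v u u<v (≈-pred k u≈v)

  rep-unique : ∀ k {v w} → IsRep k v → IsRep k w → v ≈[ k ] w → v ≡ w
  rep-unique k {v} {w} rep-v rep-w v≈w with <-cmp (toℕ v) (toℕ w)
  ... | tri< v<w _ _ = contradiction v≈w (rep-w v v<w)
  ... | tri≈ _ v≡w _ = toℕ-injective v≡w
  ... | tri> _ _ w<v = contradiction (≈-sym k v≈w) (rep-v w w<v)

  repOf : ∀ k x → Σ (Fin n) λ m → IsRep k m × m ≈[ k ] x
  repOf k x with least (λ z → ≈? k z x) (≈-refl k)
  ... | m , m≈x , below = m , (λ u u<m u≈m → below u u<m (≈-trans k u≈m m≈x)) , m≈x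

  NewRep : ℕ → Fin n → Set
  NewRep k y = IsRep (suc k) y × ¬ IsRep k y

  classes-grow : ∀ k {y} → NewRep k y → suc (classes k) ≤ classes (suc k)
  classes-grow k (new , ¬old) =
    count-strict (isRep? k) (isRep? (suc k)) (allFin n) (λ _ → rep-mono k) (∈-allFin _) new ¬old

  classes-grow₂ : ∀ k {y y'} → y ≢ y' → NewRep k y → NewRep k y' → 2 + classes k ≤ classes (suc k)
  classes-grow₂ k y≢y' (new , ¬old) (new' , ¬old') =
    count-strict₂ _≟_ (isRep? k) (isRep? (suc k)) (allFin n) (λ _ → rep-mono k)
                  y≢y' (∈-allFin _) (∈-allFin _) new ¬old new' ¬old'

  newRep : ∀ k {m x} → IsRep k m → m ≈[ k ] x → ¬ m ≈[ suc k ] x →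
           Σ (Fin n) λ y → NewRep k y × y ≈[ suc k ] x
  newRep k {m} {x} rep-m m≈x m≉x with repOf (suc k) x
  ... | y , rep-y , y≈x = y , (rep-y , old) , y≈x
    where
      old : ¬ IsRep k y
      old rep-y' with rep-unique k rep-m rep-y' (≈-trans k m≈x (≈-sym k (≈-pred k y≈x)))
      ... | refl = m≉x y≈x

  -- A pair separated in round k+1 yields a new class inside their round-k class:
  -- the representative is separated from one of the two.
  splitNew : ∀ k {a b} → a ≈[ k ] b → ¬ a ≈[ suc k ] b → Σ (Fin n) λ y → NewRep k y × y ≈[ k ] a
  splitNew k {a} {b} a≈b a≉b with repOf k a
  ... | m , rep-m , m≈a with ≈? (suc k) m a
  ...   | no m≉a with newRep k rep-m m≈a m≉a
  ...     | y , new , y≈a = y , new , ≈-pred k y≈a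
  splitNew k {a} {b} a≈b a≉b | m , rep-m , m≈a | yes m≈a'
    with newRep k rep-m (≈-trans k m≈a a≈b) (≈-≉ (suc k) m≈a' a≉b)
  ... | y , new , y≈b = y , new , ≈-trans k (≈-pred k y≈b) (≈-sym k a≈b)

  classes-split₂ : ∀ k {a b c d} → a ≈[ k ] b → ¬ a ≈[ suc k ] b → c ≈[ k ] d → ¬ c ≈[ suc k ] d →
                   ¬ a ≈[ k ] c → 2 + classes k ≤ classes (suc k)
  classes-split₂ k a≈b a≉b c≈d c≉d a≉c with splitNew k a≈b a≉b | splitNew k c≈d c≉d
  ... | y , new , y≈a | y' , new' , y'≈c = classes-grow₂ k distinct new new'
    where
      distinct : y ≢ y'
      distinct refl = a≉c (≈-trans k (≈-sym k y≈a) y'≈c)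

  classes-two-off : ∀ k {m x x'} → IsRep k m → m ≈[ k ] x → m ≈[ k ] x' →
                    ¬ m ≈[ suc k ] x → ¬ m ≈[ suc k ] x' → ¬ x ≈[ suc k ] x' →
                    2 + classes k ≤ classes (suc k)
  classes-two-off k rep-m m≈x m≈x' m≉x m≉x' x≉x'
    with newRep k rep-m m≈x m≉x | newRep k rep-m m≈x' m≉x'
  ... | y , new , y≈x | y' , new' , y'≈x' = classes-grow₂ k distinct new new'
    where
      distinct : y ≢ y'
      distinct refl = x≉x' (≈-trans (suc k) (≈-sym (suc k) y≈x) y'≈x')

  -- A round-k class splitting into three classes creates two new classes: the
  -- representative is separated from at least two of the three.
  classes-split₃ : ∀ k {a b c} → a ≈[ k ] b → a ≈[ k ] c →
                   ¬ a ≈[ suc k ] b → ¬ a ≈[ suc k ] c → ¬ b ≈[ suc k ] c →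
                   2 + classes k ≤ classes (suc k)
  classes-split₃ k {a} {b} {c} a≈b a≈c a≉b a≉c b≉c with repOf k a
  ... | m , rep-m , m≈a with ≈? (suc k) m a | ≈? (suc k) m b
  ...   | yes m≈a' | _ = classes-two-off k rep-m (≈-trans k m≈a a≈b) (≈-trans k m≈a a≈c)
                           (≈-≉ (suc k) m≈a' a≉b) (≈-≉ (suc k) m≈a' a≉c) b≉c
  ...   | no m≉a | yes m≈b' = classes-two-off k rep-m m≈a (≈-trans k m≈a a≈c)
                                m≉a (≈-≉ (suc k) m≈b' b≉c) a≉c
  ...   | no m≉a | no m≉b = classes-two-off k rep-m m≈a (≈-trans k m≈a a≈b) m≉a m≉b a≉b

-- A graph on j+1 vertices whose partition changes in every round k < j, as in
-- a long-refinement graph with WL₁(G) = j.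
module Rigid {j : ℕ} (G : Graph (suc j)) (minimal : ∀ k → k < j → ¬ Stable G k) where
  open Refinement G
  open Classes G

  split-pair : ∀ k → ¬ Stable G k →
               Σ (Fin (suc j)) λ a → Σ (Fin (suc j)) λ b → a ≈[ k ] b × ¬ a ≈[ suc k ] b
  split-pair k unstable with all? (λ v → all? (λ w → sameColour G k v w ≟ᴮ sameColour G (suc k) v w))
  ... | yes stable = contradiction stable unstable
  ... | no ¬stable with ¬∀⟶∃¬ _ _ (λ v → all? (λ w → sameColour G k v w ≟ᴮ sameColour G (suc k) v w)) ¬stable
  ...   | a , ¬stable-a with ¬∀⟶∃¬ _ _ (λ w → sameColour G k a w ≟ᴮ sameColour G (suc k) a w) ¬stable-a
  ...     | b , changed with ≈? k a b
  ...       | yes a≈b = a , b , a≈b , λ a≈'b → changed (T-ext (λ _ → a≈'b) (≈-pred k))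
  ...       | no a≉b  =
    contradiction (T-ext (λ a≈b → contradiction a≈b a≉b) (λ a≈'b → contradiction (≈-pred k a≈'b) a≉b)) changed

  classes-step : ∀ k → k < j → suc (classes k) ≤ classes (suc k)
  classes-step k k<j with split-pair k (minimal k k<j)
  ... | a , b , a≈b , a≉b with splitNew k a≈b a≉b
  ...   | _ , new , _ = classes-grow k new

  classes-lower : ∀ k → k ≤ j → suc k ≤ classes k
  classes-lower zero    _   = count-pos (isRep? 0) (∈-allFin fzero) (λ _ ())
  classes-lower (suc k) k<j = ≤-trans (s≤s (classes-lower k (<⇒≤ k<j))) (classes-step k k<j)

  -- Each of the remaining d rounds adds a class, and there are at most j+1.
  classes-room : ∀ d k → k + d ≡ j → classes k + d ≤ suc j
  classes-room zero    k _       = subst (_≤ suc j) (sym (+-identityʳ (classes k))) (classes-≤ k)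
  classes-room (suc d) k k+d+1≡j = begin
    classes k + suc d    ≡⟨ +-suc (classes k) d ⟩
    suc (classes k) + d  ≤⟨ +-monoˡ-≤ d (classes-step k k<j) ⟩
    classes (suc k) + d  ≤⟨ classes-room d (suc k) (trans (sym (+-suc k d)) k+d+1≡j) ⟩
    suc j                ∎
    where
      open ≤-Reasoning
      k<j : k < j
      k<j = ≤-trans (s≤s (m≤m+n k d)) (≤-reflexive (trans (sym (+-suc k d)) k+d+1≡j))

  classes-exact : ∀ k → k ≤ j → classes k ≡ suc k
  classes-exact k k≤j = ≤-antisym upper (classes-lower k k≤j)
    where
      upper : classes k ≤ suc k
      upper = +-cancelʳ-≤ (j ∸ k) (classes k) (suc k)
        (subst (classes k + (j ∸ k) ≤_) (cong suc (sym (m+[n∸m]≡n k≤j)))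
               (classes-room (j ∸ k) k (m+[n∸m]≡n k≤j)))

  one-new-class : ∀ k → k < j → ¬ (2 + classes k ≤ classes (suc k))
  one-new-class k k<j double =
    1+n≰n (subst₂ _≤_ (cong (2 +_) (classes-exact k (<⇒≤ k<j))) (classes-exact (suc k) k<j) double)

  discrete : ∀ {u v} → u ≈[ j ] v → u ≡ v
  discrete = rep-unique j (all-rep _) (all-rep _)
    where
      all-rep : ∀ v → IsRep j v
      all-rep v = count-full (isRep? j) (trans (classes-exact j ≤-refl) (sym (length-tabulate id))) (∈-allFin v)

  one-split-class : ∀ k → k < j → ∀ {a b} → a ≈[ k ] b → ¬ a ≈[ suc k ] b →
                    ∀ {y z} → y ≈[ k ] z → ¬ y ≈[ suc k ] z → y ≈[ k ] a
  one-split-class k k<j {a} a≈b a≉b {y} y≈z y≉z with ≈? k y a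
  ... | yes y≈a = y≈a
  ... | no y≉a  = ⊥-elim (one-new-class k k<j (classes-split₂ k y≈z y≉z a≈b a≉b y≉a))

  leaf-split-early : ∀ p {u b} → 1 ≤ p → suc p < j → deg G u ≡ 1 →
                     u ≈[ p ] b → ¬ u ≈[ suc p ] b → ⊥
  leaf-split-early p 1≤p p+1<j leaf-u u≈b u≉b =
    minimal (suc p) p+1<j (LeafSplit.stable p 1≤p leaf-u (one-split-class p (<⇒≤ p+1<j) u≈b u≉b))

  three-split-last : ∀ p {a b c} → suc p ≡ j → a ≈[ p ] b → a ≈[ p ] c →
                     a ≢ b → a ≢ c → b ≢ c → ⊥
  three-split-last p p+1≡j a≈b a≈c a≢b a≢c b≢c =
    one-new-class p (≤-reflexive p+1≡j) (classes-split₃ p a≈b a≈c (apart a≢b) (apart a≢c) (apart b≢c))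
    where
      apart : ∀ {v w} → v ≢ w → ¬ v ≈[ suc p ] w
      apart v≢w v≈w = v≢w (discrete (subst (λ i → _ ≈[ i ] _) p+1≡j v≈w))

  no-three-leaves : ∀ {u₁ u₂ u₃} → u₁ ≢ u₂ → u₁ ≢ u₃ → u₂ ≢ u₃ →
                    deg G u₁ ≡ 1 → deg G u₂ ≡ 1 → deg G u₃ ≡ 1 → ⊥
  no-three-leaves {u₁} {u₂} {u₃} u₁≢u₂ u₁≢u₃ u₂≢u₃ d₁ d₂ d₃
    with crossing together? (deg-≈₁ (trans d₁ (sym d₂)) , deg-≈₁ (trans d₁ (sym d₃))) 1≤j
                  (λ (u₁≈u₂ , _) → u₁≢u₂ (discrete u₁≈u₂))
    where
      together? : Decidable (λ k → u₁ ≈[ k ] u₂ × u₁ ≈[ k ] u₃)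
      together? k = ≈? k u₁ u₂ ×-dec ≈? k u₁ u₃
      1≤j : 1 ≤ j
      1≤j = n≢0⇒n>0 (λ j≡0 → u₁≢u₂ (discrete (subst (λ i → u₁ ≈[ i ] u₂) (sym j≡0) _)))
  ... | p , 1≤p , p<j , (u₁≈u₂ , u₁≈u₃) , not-together with m≤n⇒m<n∨m≡n p<j | ≈? (suc p) u₁ u₂
  ...   | inj₂ p+1≡j | _        = three-split-last p p+1≡j u₁≈u₂ u₁≈u₃ u₁≢u₂ u₁≢u₃ u₂≢u₃
  ...   | inj₁ p+1<j | yes u₁≈u₂' =
    leaf-split-early p 1≤p p+1<j d₁ u₁≈u₃ (λ u₁≈u₃' → not-together (u₁≈u₂' , u₁≈u₃'))
  ...   | inj₁ p+1<j | no u₁≉u₂   = leaf-split-early p 1≤p p+1<j d₁ u₁≈u₂ u₁≉u₂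

lemma13 : ∀ {n} (G : Graph n) → LongRefinement G → numDeg1 G ≤ 2
lemma13 G (j , (_ , minimal) , refl) =
  length≤2 (Unique.filter⁺ leaf? (Unique.allFin⁺ _))
    λ u₁∈ u₂∈ u₃∈ u₁≢u₂ u₁≢u₃ u₂≢u₃ →
      Rigid.no-three-leaves G minimal u₁≢u₂ u₁≢u₃ u₂≢u₃ (is-leaf u₁∈) (is-leaf u₂∈) (is-leaf u₃∈)
  where
    leaf? : Decidable (λ v → T (deg G v ≡ᵇ 1))
    leaf? v = T? (deg G v ≡ᵇ 1)
    is-leaf : ∀ {v} → v ∈ filter leaf? (allFin _) → deg G v ≡ 1
    is-leaf v∈ = ≡ᵇ⇒≡ _ 1 (proj₂ (∈-filter⁻ leaf? {xs = allFin _} v∈))
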